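{- Let $n>k$ be natural numbers, write $n=ki+t$ with integers $i\geqslant 1$ and $1\leqslant t\leqslant k$, and let $G$ be a graph on $n$ vertices. Partition $\{0,1,\dots,n-1\}$ into $i+1$ intervals of consecutive integers $I_0,I_1,\dots,I_i$, each of size at most $k$, numbered in increasing order, and for $j=0,\dots,i$ let the $j$-th group be the set of vertices of $G$ whose degree lies in $I_j$. Suppose that for some integer $p_2\geqslant 0$ every group contains at least $t+p_2$ vertices. Let $x$ be the average degree of the vertices of the $0$-th group. Then the average degree of the vertices of the $i$-th group is at most $ki+x-p_2-1$.
   Context: All graphs are finite, undirected, without loops or multiple edges. -}

module Defs where

open import Data.Nat using (ℕ; zero; suc; _+_; _*_; _≤_; _<_; _≤ᵇ_; _<ᵇ_)
open import Data.Bool using (Bool; true; false; if_then_else_; _∧_)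
open import Data.Fin using (Fin)
open import Data.List using (List; allFin; map; length; filterᵇ)
open import Data.Nat.ListAction using (sum)
open import Relation.Binary.PropositionalEquality using (_≡_)

record Graph (n : ℕ) : Set where
  field
    adj     : Fin n → Fin n → Bool
    symm    : ∀ u v → adj u v ≡ adj v u
    irrefl  : ∀ v → adj v v ≡ false
open Graph public

degree : ∀ {n} → Graph n → Fin n → ℕ
degree {n} G v = length (filterᵇ (adj G v) (allFin n))

-- An interval partition of {0,…,n-1} into i+1 intervals I_0,…,I_i of
-- consecutive integers, in increasing order, each nonempty and of size ≤ k:
-- given by boundaries b 0 = 0 < b 1 < … < b (i+1) = n, with I_j = [b j, b (j+1)).
record IntervalPartition (n k i : ℕ) : Set where
  field
    bd        : ℕ → ℕ
    bd-zero   : bd 0 ≡ 0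
    bd-last   : bd (suc i) ≡ n
    bd-incr   : ∀ j → j ≤ i → bd j < bd (suc j)
    bd-size   : ∀ j → j ≤ i → bd (suc j) ≤ bd j + k
open IntervalPartition public

inGroup : ∀ {n k i} → Graph n → IntervalPartition n k i → ℕ → Fin n → Bool
inGroup G P j v = (bd P j ≤ᵇ degree G v) ∧ (degree G v <ᵇ bd P (suc j))

group : ∀ {n k i} → Graph n → IntervalPartition n k i → ℕ → List (Fin n)
group {n} G P j = filterᵇ (inGroup G P j) (allFin n)

groupSize : ∀ {n k i} → Graph n → IntervalPartition n k i → ℕ → ℕ
groupSize G P j = length (group G P j)

groupDegSum : ∀ {n k i} → Graph n → IntervalPartition n k i → ℕ → ℕ
groupDegSum G P j = sum (map (degree G) (group G P j))

-- Let A be the top group and B the bottom group, a = |A|, g = |B|, s = t + p₂ ≤ a, g,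
-- and e the number of edges between A and B. A vertex of A lies outside B and is not
-- its own neighbour, so its degree is at most (n - g - 1) + (its neighbours in B);
-- summing, S_A + a (g + 1) ≤ a n + e. Each vertex of B has at most min(deg, a)
-- neighbours in A, so e ≤ S_B and e ≤ g a; splitting g e = s e + (g - s) e gives
-- g e ≤ a S_B + (g - s) g a. Eliminating e and using n = k i + t leaves the claim.
module Submission where

open import Defs
open import Data.Bool using (Bool; true; false; T; not; _∨_)
open import Data.Bool.Properties using (T-∧; T-not-≡; ∧-zeroʳ)
open import Data.Fin using (Fin)
open import Data.List using (List; []; _∷_; allFin; map; length; filterᵇ)
open import Data.List.Properties using (length-filter; filter-some; filter-≐; length-tabulate; map-cong)
open import Data.List.Membership.Propositional using (_∈_; lose)
open import Data.List.Membership.Propositional.Properties using (∈-allFin; ∈-filter⁻)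
open import Data.List.Relation.Unary.Any using (here; there)
open import Data.List.Relation.Binary.Sublist.Propositional.Properties using (filter⁺; filter-⊆; length-mono-≤)
open import Data.Nat using (ℕ; suc; _+_; _*_; _≤_; _<_; _≤′_; _<ᵇ_; z≤n; s≤s⁻¹; ≤′-refl; ≤′-step)
open import Data.Nat.ListAction using (sum)
open import Data.Nat.Properties
open import Data.Nat.Tactic.RingSolver using (solve)
open import Algebra.Properties.CommutativeSemigroup +-commutativeSemigroup using (interchange; x∙yz≈y∙xz)
open import Data.Product using (_,_; proj₁; proj₂)
open import Function using (_∘_; id)
open import Function.Bundles using (Equivalence)
open import Relation.Binary.PropositionalEquality
open import Relation.Nullary using (contradiction)
open import Relation.Nullary.Decidable using (T?)

count : {A : Set} → (A → Bool) → List A → ℕ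
count p xs = length (filterᵇ p xs)

module _ {A : Set} where

  count-filterᵇ-≤ : (p q : A → Bool) (xs : List A) → count p (filterᵇ q xs) ≤ count p xs
  count-filterᵇ-≤ p q xs =
    length-mono-≤ (filter⁺ (T? ∘ p) (T? ∘ p) (subst (T ∘ p)) (filter-⊆ (T? ∘ q) xs))

  count-inclusion-exclusion : (p q : A → Bool) (xs : List A) →
    count p xs + count q xs + count (λ x → not (p x ∨ q x)) xs ≡ length xs + count p (filterᵇ q xs)
  count-inclusion-exclusion p q [] = refl
  count-inclusion-exclusion p q (x ∷ xs) with ih ← count-inclusion-exclusion p q xs | q x
  ... | true with p x
  ...   | true  rewrite +-suc (count p xs) (count q xs)
                      | +-suc (length xs) (count p (filterᵇ q xs)) = cong (2 +_) ih
  ...   | false rewrite +-suc (count p xs) (count q xs) = cong suc ih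
  count-inclusion-exclusion p q (x ∷ xs) | false with p x
  ...   | true  = cong suc ih
  ...   | false = trans (+-suc _ _) (cong suc ih)

  count-union-< : (p q : A → Bool) {x : A} {xs : List A} → x ∈ xs → p x ≡ false → q x ≡ false →
    count p xs + suc (count q xs) ≤ length xs + count p (filterᵇ q xs)
  count-union-< p q {x} {xs} x∈xs px qx = begin
    count p xs + suc (count q xs)                               ≡⟨ +-suc _ _ ⟩
    suc (count p xs + count q xs)                               ≡⟨ +-comm 1 _ ⟩
    count p xs + count q xs + 1                                 ≤⟨ +-monoʳ-≤ _ neither-nonempty ⟩
    count p xs + count q xs + count (λ x → not (p x ∨ q x)) xs  ≡⟨ count-inclusion-exclusion p q xs ⟩
    length xs + count p (filterᵇ q xs)                          ∎
    where
    open ≤-Reasoning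
    neither-nonempty : 1 ≤ count (λ x → not (p x ∨ q x)) xs
    neither-nonempty = filter-some (T? ∘ λ x → not (p x ∨ q x))
                         (lose x∈xs (Equivalence.from T-not-≡ (cong₂ _∨_ px qx)))

  sum-map-+ : (f g : A → ℕ) (xs : List A) →
    sum (map (λ x → f x + g x) xs) ≡ sum (map f xs) + sum (map g xs)
  sum-map-+ f g [] = refl
  sum-map-+ f g (x ∷ xs) =
    trans (cong (f x + g x +_) (sum-map-+ f g xs)) (interchange (f x) (g x) _ _)

  sum-map-const : (c : ℕ) (xs : List A) → sum (map (λ _ → c) xs) ≡ length xs * c
  sum-map-const c [] = refl
  sum-map-const c (x ∷ xs) = cong (c +_) (sum-map-const c xs)

  sum-map-mono : {f g : A → ℕ} (xs : List A) → (∀ {x} → x ∈ xs → f x ≤ g x) →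
    sum (map f xs) ≤ sum (map g xs)
  sum-map-mono [] f≤g = z≤n
  sum-map-mono (x ∷ xs) f≤g = +-mono-≤ (f≤g (here refl)) (sum-map-mono xs (f≤g ∘ there))

  count-cong : {p q : A → Bool} → (∀ x → p x ≡ q x) → (xs : List A) → count p xs ≡ count q xs
  count-cong {p} {q} p≗q xs =
    cong length (filter-≐ (T? ∘ p) (T? ∘ q) ((λ {x} → subst T (p≗q x)) , (λ {x} → subst T (sym (p≗q x)))) xs)

sum-map-count-swap : {A B : Set} (R : A → B → Bool) (xs : List A) (ys : List B) →
  sum (map (λ x → count (R x) ys) xs) ≡ sum (map (λ y → count (λ x → R x y) xs) ys)
sum-map-count-swap R [] ys = sym (trans (sum-map-const 0 ys) (*-zeroʳ (length ys)))
sum-map-count-swap {B = B} R (x ∷ xs) ys =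
  trans (cong (count (R x) ys +_) (sum-map-count-swap R xs ys)) (sym (column-cons ys))
  where
  column : B → ℕ
  column y = count (λ x′ → R x′ y) xs

  column-cons : ∀ ys → sum (map (λ y → count (λ x′ → R x′ y) (x ∷ xs)) ys)
                       ≡ count (R x) ys + sum (map column ys)
  column-cons [] = refl
  column-cons (y ∷ ys) with ih ← column-cons ys | R x y
  ... | true  = cong suc (trans (cong (column y +_) ih) (x∙yz≈y∙xz (column y) (count (R x) ys) _))
  ... | false = trans (cong (column y +_) ih) (x∙yz≈y∙xz (column y) (count (R x) ys) _)

module _ {n : ℕ} (G : Graph n) where

  degreeIn : List (Fin n) → Fin n → ℕ
  degreeIn S v = count (adj G v) S

  degreeSum : List (Fin n) → ℕ
  degreeSum S = sum (map (degree G) S)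

  edges : List (Fin n) → List (Fin n) → ℕ
  edges S T = sum (map (degreeIn T) S)

  edges-comm : (S T : List (Fin n)) → edges S T ≡ edges T S
  edges-comm S T = trans (sum-map-count-swap (adj G) S T)
                         (cong sum (map-cong (λ u → count-cong (λ v → symm G v u) S) T))

  edges≤length*length : (S T : List (Fin n)) → edges S T ≤ length S * length T
  edges≤length*length S T = ≤-trans (sum-map-mono S (λ {v} _ → length-filter (T? ∘ adj G v) T))
                                    (≤-reflexive (sum-map-const (length T) S))

  edges≤degreeSum : (S : List (Fin n)) (q : Fin n → Bool) → edges S (filterᵇ q (allFin n)) ≤ degreeSum S
  edges≤degreeSum S q = sum-map-mono S (λ {v} _ → count-filterᵇ-≤ (adj G v) q (allFin n))

  degree+size<n+degreeIn : (q : Fin n → Bool) {v : Fin n} → q v ≡ false →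
    degree G v + suc (count q (allFin n)) ≤ n + degreeIn (filterᵇ q (allFin n)) v
  degree+size<n+degreeIn q {v} qv =
    ≤-trans (count-union-< (adj G v) q (∈-allFin v) (irrefl G v) qv)
            (+-monoˡ-≤ (degreeIn (filterᵇ q (allFin n)) v) (≤-reflexive (length-tabulate id)))

  degreeSum-outside : (S : List (Fin n)) (q : Fin n → Bool) → (∀ {v} → v ∈ S → q v ≡ false) →
    degreeSum S + length S * suc (count q (allFin n)) ≤ length S * n + edges S (filterᵇ q (allFin n))
  degreeSum-outside S q S∩q≡∅ = begin
    degreeSum S + length S * suc (count q V)          ≡⟨ cong (degreeSum S +_) (sum-map-const _ S) ⟨
    degreeSum S + sum (map (λ _ → suc (count q V)) S) ≡⟨ sum-map-+ (degree G) _ S ⟨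
    sum (map (λ v → degree G v + suc (count q V)) S)  ≤⟨ sum-map-mono S (degree+size<n+degreeIn q ∘ S∩q≡∅) ⟩
    sum (map (λ v → n + degreeIn (filterᵇ q V) v) S)  ≡⟨ sum-map-+ _ (degreeIn (filterᵇ q V)) S ⟩
    sum (map (λ _ → n) S) + edges S (filterᵇ q V)     ≡⟨ cong (_+ edges S (filterᵇ q V)) (sum-map-const n S) ⟩
    length S * n + edges S (filterᵇ q V)              ∎
    where
    open ≤-Reasoning
    V = allFin n

module _ {n k i : ℕ} (P : IntervalPartition n k i) where

  bd-mono : ∀ {j l} → j ≤ l → l ≤ suc i → bd P j ≤ bd P l
  bd-mono j≤l = mono (≤⇒≤′ j≤l)
    where
    mono : ∀ {j l} → j ≤′ l → l ≤ suc i → bd P j ≤ bd P l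
    mono ≤′-refl _ = ≤-refl
    mono (≤′-step j≤′l) l<1+i = ≤-trans (mono j≤′l (<⇒≤ l<1+i)) (<⇒≤ (bd-incr P _ (s≤s⁻¹ l<1+i)))

  inGroup-disjoint : (G : Graph n) {j l : ℕ} → j < l → l ≤ i →
    ∀ {v} → T (inGroup G P l v) → inGroup G P j v ≡ false
  inGroup-disjoint G {j} {l} j<l l≤i {v} v∈l
    with degree G v <ᵇ bd P (suc j) | <ᵇ⇒< (degree G v) (bd P (suc j))
  ... | false | _         = ∧-zeroʳ _
  ... | true  | below-end = contradiction (≤-trans (bd-mono j<l (m≤n⇒m≤1+n l≤i)) above-start)
                                          (<⇒≱ (below-end _))
    where
    above-start : bd P l ≤ degree G v
    above-start = ≤ᵇ⇒≤ _ _ (proj₁ (Equivalence.to T-∧ v∈l))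

average-bound : ∀ {n k i t p a g SA SB E : ℕ} → n ≡ k * i + t → t + p ≤ a → t + p ≤ g →
  SA + a * suc g ≤ a * n + E → E ≤ SB → E ≤ g * a →
  SA * g + suc p * a * g ≤ k * i * a * g + SB * a
average-bound {k = k} {i} {t} {p} {a} {SA = SA} {SB} {E} refl s≤a s≤g top E≤SB E≤ga
  with r , refl ← m≤n⇒∃[o]m+o≡n s≤g =
  +-cancelʳ-≤ (a * (t + p + r) * (t + r)) _ _ (begin
    SA * (t + p + r) + suc p * a * (t + p + r) + a * (t + p + r) * (t + r)
      ≡⟨ solve (SA ∷ p ∷ a ∷ t ∷ r ∷ []) ⟩
    (t + p + r) * (SA + a * suc (t + p + r))
      ≤⟨ *-monoʳ-≤ (t + p + r) top ⟩
    (t + p + r) * (a * (k * i + t) + E)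
      ≡⟨ *-distribˡ-+ (t + p + r) _ E ⟩
    (t + p + r) * (a * (k * i + t)) + (t + p + r) * E
      ≤⟨ +-monoʳ-≤ _ split ⟩
    (t + p + r) * (a * (k * i + t)) + (a * SB + r * ((t + p + r) * a))
      ≡⟨ solve (SA ∷ p ∷ a ∷ t ∷ r ∷ k ∷ i ∷ SB ∷ []) ⟩
    k * i * a * (t + p + r) + SB * a + a * (t + p + r) * (t + r) ∎)
  where
  open ≤-Reasoning
  split : (t + p + r) * E ≤ a * SB + r * ((t + p + r) * a)
  split = begin
    (t + p + r) * E      ≡⟨ *-distribʳ-+ E (t + p) r ⟩
    (t + p) * E + r * E  ≤⟨ +-mono-≤ (*-mono-≤ s≤a E≤SB) (*-monoʳ-≤ r E≤ga) ⟩
    a * SB + r * ((t + p + r) * a) ∎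

lemma3 : (n k i t p₂ : ℕ) → k < n → n ≡ k * i + t → 1 ≤ i → 1 ≤ t → t ≤ k →
    (G : Graph n) → (P : IntervalPartition n k i) →
    (∀ j → j ≤ i → t + p₂ ≤ groupSize G P j) →
    groupDegSum G P i * groupSize G P 0 + suc p₂ * groupSize G P i * groupSize G P 0
      ≤ k * i * groupSize G P i * groupSize G P 0 + groupDegSum G P 0 * groupSize G P i
lemma3 n k i t p₂ _ n≡ki+t 1≤i _ _ G P large =
  average-bound {k = k} {i} {t} {p₂} n≡ki+t (large i ≤-refl) (large 0 z≤n) top-degrees
    (edges≤degreeSum G bottom (inGroup G P i)) (edges≤length*length G bottom top)
  where
  top bottom : List (Fin n)
  top    = group G P i
  bottom = group G P 0
  top-degrees : degreeSum G top + length top * suc (length bottom) ≤ length top * n + edges G bottom top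
  top-degrees = ≤-trans
    (degreeSum-outside G top (inGroup G P 0)
      (λ v∈top → inGroup-disjoint P G 1≤i ≤-refl (proj₂ (∈-filter⁻ (T? ∘ inGroup G P i) {xs = allFin n} v∈top))))
    (≤-reflexive (cong (length top * n +_) (edges-comm G top bottom)))
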